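{- Let $P$ be the infinite matrix indexed by the non-negative integers with $P(r+1,r)=1$, $P(r,r)=r-1$, $P(r,r+1)=-r-1$ for $r\geq0$, and $P(r,s)=0$ for $|r-s|>1$. Then for all $j\geq 1$, $r\geq 0$, $s\geq 0$, \[(-1)^r r!\,P^j(r,s)=(-1)^s s!\,P^j(s,r).\]
   Context: Powers of $P$ are well defined since each row and column of $P$ has finitely many nonzero entries. -}

module Defs where

open import Data.Nat as ℕ using (ℕ; zero; suc)
open import Data.Integer using (ℤ; +_; -_; _+_; _-_; _*_; 0ℤ; 1ℤ)
open import Data.List using (List; foldr; map; upTo)
open import Relation.Nullary using (yes; no)

P : ℕ → ℕ → ℤ
P r s with s ℕ.≟ r
... | yes _ = + r - 1ℤ
... | no _ with r ℕ.≟ suc s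
...   | yes _ = 1ℤ
...   | no _ with s ℕ.≟ suc r
...     | yes _ = - (+ r) - 1ℤ
...     | no _ = 0ℤ

Σ< : ℕ → (ℕ → ℤ) → ℤ
Σ< n f = foldr _+_ 0ℤ (map f (upTo n))

I : ℕ → ℕ → ℤ
I r s with r ℕ.≟ s
... | yes _ = 1ℤ
... | no _ = 0ℤ

-- Powers of P: P^(j+1)(r,s) = Σ_k P^j(r,k) P(k,s).  Since P(k,s) = 0 for
-- k > s+1, the (formally infinite) sum is exactly the finite sum over k ≤ s+1.
Ppow : ℕ → ℕ → ℕ → ℤ
Ppow zero r s = I r s
Ppow (suc j) r s = Σ< (suc (suc s)) (λ k → Ppow j r k * P k s)

-- With D = diag((-1)^r r!) the identity says that D Pʲ is symmetric.  D P is
-- symmetric, since the weights of rows r and r+1 differ by the factor -(r+1)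
-- relating P(r,r+1) to P(r+1,r); and Pʲ commutes with P, so inductively
-- D Pʲ⁺¹ = (D Pʲ) P = (Pʲ)ᵀ (D P) = (Pʲ)ᵀ Pᵀ D = (P Pʲ)ᵀ D = (Pʲ⁺¹)ᵀ D.
module Submission where

open import Defs
open import Data.Nat using (ℕ; _≤_)
open import Data.Nat using (_!)
open import Data.Integer using (ℤ; +_; -_; _*_; _^_; 1ℤ)
open import Relation.Binary.PropositionalEquality using (_≡_)

open import Data.Nat using (zero; suc; pred; _<_; _≟_; s≤s)
open import Data.Nat.Properties using (<-trans; <⇒≢; 1+n≢n; n<1+n)
open import Data.Integer using (_+_; _-_; 0ℤ)
open import Data.Integer.Properties
  using (+-comm; +-assoc; +-identityˡ; *-assoc; *-comm; *-zeroʳ; *-distribˡ-+; pos-*;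
         +-commutativeSemigroup; *-commutativeSemigroup)
open import Data.Integer.Tactic.RingSolver using (solve-∀)
open import Algebra.Properties.CommutativeSemigroup +-commutativeSemigroup as +-Semigroup using ()
open import Algebra.Properties.CommutativeSemigroup *-commutativeSemigroup as *-Semigroup using ()
open import Data.List using (_∷ʳ_; [_]; map; foldr; upTo)
open import Data.List.Properties using (upTo-∷ʳ; map-++; foldr-++; foldr-fusion)
open import Data.Empty using (⊥-elim)
open import Function using (_∘_)
open import Relation.Nullary using (yes; no; ¬_)
open import Relation.Binary.PropositionalEquality using (refl; sym; trans; cong; cong₂; module ≡-Reasoning)
open ≡-Reasoning

Σ<-suc : ∀ n f → Σ< (suc n) f ≡ Σ< n f + f n
Σ<-suc n f = begin
  foldr _+_ 0ℤ (map f (upTo (suc n)))       ≡⟨ cong (foldr _+_ 0ℤ ∘ map f) (sym (upTo-∷ʳ n)) ⟩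
  foldr _+_ 0ℤ (map f (upTo n ∷ʳ n))        ≡⟨ cong (foldr _+_ 0ℤ) (map-++ f (upTo n) [ n ]) ⟩
  foldr _+_ 0ℤ (map f (upTo n) ∷ʳ f n)      ≡⟨ foldr-++ _+_ 0ℤ (map f (upTo n)) [ f n ] ⟩
  foldr _+_ (f n + 0ℤ) (map f (upTo n))     ≡⟨ cong (λ c → foldr _+_ c (map f (upTo n))) (+-comm (f n) 0ℤ) ⟩
  foldr _+_ (0ℤ + f n) (map f (upTo n))     ≡⟨ foldr-fusion (_+ f n) 0ℤ (λ x y → +-assoc x y (f n)) (map f (upTo n)) ⟨
  Σ< n f + f n                              ∎

Σ<-vanishing : ∀ n f → (∀ k → k < n → f k ≡ 0ℤ) → Σ< n f ≡ 0ℤ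
Σ<-vanishing zero f _ = refl
Σ<-vanishing (suc n) f f≡0 = begin
  Σ< (suc n) f   ≡⟨ Σ<-suc n f ⟩
  Σ< n f + f n   ≡⟨ cong₂ _+_ (Σ<-vanishing n f (λ k k<n → f≡0 k (<-trans k<n (n<1+n n)))) (f≡0 n (n<1+n n)) ⟩
  0ℤ             ∎

Matrix : Set
Matrix = ℕ → ℕ → ℤ

infix 4 _≈_
_≈_ : Matrix → Matrix → Set
M ≈ N = ∀ r s → M r s ≡ N r s

-- T(k+1,k) = lower k, T(k,k) = diag k, T(k,k+1) = upper k.
record Tridiagonal : Set where
  field
    lower diag upper : ℕ → ℤ

open Tridiagonal

-- above T s = T(s-1,s) and below T r = T(r,r-1) vanish at index 0, which kills
-- the junk entries M r (pred 0) and M (pred 0) s in the products below.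
above : Tridiagonal → ℕ → ℤ
above T zero = 0ℤ
above T (suc s) = upper T s

below : Tridiagonal → ℕ → ℤ
below T zero = 0ℤ
below T (suc r) = lower T r

infixl 7 _⊙_ _⊛_

_⊙_ : Matrix → Tridiagonal → Matrix
(M ⊙ T) r s = M r (pred s) * above T s + M r s * diag T s + M r (suc s) * lower T s

_⊛_ : Tridiagonal → Matrix → Matrix
(T ⊛ M) r s = below T r * M (pred r) s + diag T r * M r s + upper T r * M (suc r) s

⊙-cong : ∀ {M N} T → M ≈ N → M ⊙ T ≈ N ⊙ T
⊙-cong T M≈N r s rewrite M≈N r (pred s) | M≈N r s | M≈N r (suc s) = refl

⊛-cong : ∀ T {M N} → M ≈ N → T ⊛ M ≈ T ⊛ N
⊛-cong T M≈N r s rewrite M≈N (pred r) s | M≈N r s | M≈N (suc r) s = refl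

⊛-⊙-assoc : ∀ T M U → T ⊛ (M ⊙ U) ≈ (T ⊛ M) ⊙ U
⊛-⊙-assoc T M U r s = row-matrix-column-assoc
  (below T r) (diag T r) (upper T r) (above U s) (diag U s) (lower U s)
  (M r′ s′) (M r′ s) (M r′ s″) (M r s′) (M r s) (M r s″) (M r″ s′) (M r″ s) (M r″ s″)
  where
  r′ = pred r; r″ = suc r; s′ = pred s; s″ = suc s
  row-matrix-column-assoc : ∀ a₁ a₂ a₃ b₁ b₂ b₃ m₁₁ m₁₂ m₁₃ m₂₁ m₂₂ m₂₃ m₃₁ m₃₂ m₃₃ →
    a₁ * (m₁₁ * b₁ + m₁₂ * b₂ + m₁₃ * b₃) + a₂ * (m₂₁ * b₁ + m₂₂ * b₂ + m₂₃ * b₃)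
      + a₃ * (m₃₁ * b₁ + m₃₂ * b₂ + m₃₃ * b₃)
    ≡ (a₁ * m₁₁ + a₂ * m₂₁ + a₃ * m₃₁) * b₁ + (a₁ * m₁₂ + a₂ * m₂₂ + a₃ * m₃₂) * b₂
      + (a₁ * m₁₃ + a₂ * m₂₃ + a₃ * m₃₃) * b₃
  row-matrix-column-assoc = solve-∀

δ : Matrix
δ zero zero = 1ℤ
δ zero (suc s) = 0ℤ
δ (suc r) zero = 0ℤ
δ (suc r) (suc s) = δ r s

δ-diagonal : ∀ r → δ r r ≡ 1ℤ
δ-diagonal zero = refl
δ-diagonal (suc r) = δ-diagonal r

δ-off-diagonal : ∀ {r s} → ¬ r ≡ s → δ r s ≡ 0ℤ
δ-off-diagonal {zero} {zero} r≢s = ⊥-elim (r≢s refl)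
δ-off-diagonal {zero} {suc s} _ = refl
δ-off-diagonal {suc r} {zero} _ = refl
δ-off-diagonal {suc r} {suc s} r≢s = δ-off-diagonal (r≢s ∘ cong suc)

δ-sym : ∀ r s → δ r s ≡ δ s r
δ-sym zero zero = refl
δ-sym zero (suc s) = refl
δ-sym (suc r) zero = refl
δ-sym (suc r) (suc s) = δ-sym r s

δ-*-swap : ∀ (f : ℕ → ℤ) r s → δ r s * f s ≡ f r * δ r s
δ-*-swap f zero zero = *-comm 1ℤ (f 0)
δ-*-swap f zero (suc s) = sym (*-zeroʳ (f 0))
δ-*-swap f (suc r) zero = sym (*-zeroʳ (f (suc r)))
δ-*-swap f (suc r) (suc s) = δ-*-swap (f ∘ suc) r s

I≈δ : I ≈ δ
I≈δ r s with r ≟ s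
... | yes refl = sym (δ-diagonal r)
... | no r≢s = sym (δ-off-diagonal r≢s)

δ-⊙≈⊛-δ : ∀ T → δ ⊙ T ≈ T ⊛ δ
δ-⊙≈⊛-δ T r s = begin
  δ r (pred s) * above T s + δ r s * diag T s + δ r (suc s) * lower T s
    ≡⟨ cong₂ _+_ (cong₂ _+_ (first r s) (δ-*-swap (diag T) r s)) (last r s) ⟩
  upper T r * δ (suc r) s + diag T r * δ r s + below T r * δ (pred r) s
    ≡⟨ +-Semigroup.xy∙z≈zy∙x (upper T r * δ (suc r) s) (diag T r * δ r s) (below T r * δ (pred r) s) ⟩
  below T r * δ (pred r) s + diag T r * δ r s + upper T r * δ (suc r) s
    ∎
  where
  first : ∀ r s → δ r (pred s) * above T s ≡ upper T r * δ (suc r) s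
  first r zero = trans (*-zeroʳ (δ r 0)) (sym (*-zeroʳ (upper T r)))
  first r (suc s) = δ-*-swap (upper T) r s
  last : ∀ r s → δ r (suc s) * lower T s ≡ below T r * δ (pred r) s
  last zero s = refl
  last (suc r) s = δ-*-swap (lower T) r s

I-⊙≈⊛-I : ∀ T → I ⊙ T ≈ T ⊛ I
I-⊙≈⊛-I T r s = begin
  (I ⊙ T) r s ≡⟨ ⊙-cong T I≈δ r s ⟩
  (δ ⊙ T) r s ≡⟨ δ-⊙≈⊛-δ T r s ⟩
  (T ⊛ δ) r s ≡⟨ ⊛-cong T I≈δ r s ⟨
  (T ⊛ I) r s ∎

Symmetrizes : (ℕ → ℤ) → Matrix → Set
Symmetrizes w M = ∀ r s → w r * M r s ≡ w s * M s r

Symmetrizesᵗ : (ℕ → ℤ) → Tridiagonal → Set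
Symmetrizesᵗ w T = ∀ k → w (suc k) * lower T k ≡ w k * upper T k

symmetrizes-identity : ∀ w → Symmetrizes w I
symmetrizes-identity w r s = begin
  w r * I r s   ≡⟨ cong (w r *_) (I≈δ r s) ⟩
  w r * δ r s   ≡⟨ δ-*-swap w r s ⟨
  δ r s * w s   ≡⟨ *-comm (δ r s) (w s) ⟩
  w s * δ r s   ≡⟨ cong (w s *_) (δ-sym r s) ⟩
  w s * δ s r   ≡⟨ cong (w s *_) (I≈δ s r) ⟨
  w s * I s r   ∎

*-distribˡ-+₃ : ∀ w x y z → w * (x + y + z) ≡ w * x + w * y + w * z
*-distribˡ-+₃ w x y z = trans (*-distribˡ-+ w (x + y) z) (cong (_+ w * z) (*-distribˡ-+ w x y))

transfer-weight : ∀ {a b c m m′ t t′} → a * m ≡ b * m′ → b * t ≡ c * t′ → a * (m * t) ≡ c * (t′ * m′)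
transfer-weight {a} {b} {c} {m} {m′} {t} {t′} am≡bm′ bt≡ct′ = begin
  a * (m * t)     ≡⟨ *-assoc a m t ⟨
  a * m * t       ≡⟨ cong (_* t) am≡bm′ ⟩
  b * m′ * t      ≡⟨ *-Semigroup.xy∙z≈xz∙y b m′ t ⟩
  b * t * m′      ≡⟨ cong (_* m′) bt≡ct′ ⟩
  c * t′ * m′     ≡⟨ *-assoc c t′ m′ ⟩
  c * (t′ * m′)   ∎

-- Termwise: w_r M(r,k) T(k,s) = w_k M(k,r) T(k,s) = w_s T(s,k) M(k,r).
⊙-transpose-⊛ : ∀ {w T M} → Symmetrizesᵗ w T → Symmetrizes w M →
                ∀ r s → w r * (M ⊙ T) r s ≡ w s * (T ⊛ M) s r
⊙-transpose-⊛ {w} {T} {M} wT wM r s = begin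
  w r * (M r (pred s) * above T s + M r s * diag T s + M r (suc s) * lower T s)
    ≡⟨ *-distribˡ-+₃ (w r) _ _ _ ⟩
  w r * (M r (pred s) * above T s) + w r * (M r s * diag T s) + w r * (M r (suc s) * lower T s)
    ≡⟨ cong₂ _+_ (cong₂ _+_ (term (pred s) (weight-above s)) (term s refl)) (term (suc s) (wT s)) ⟩
  w s * (below T s * M (pred s) r) + w s * (diag T s * M s r) + w s * (upper T s * M (suc s) r)
    ≡⟨ *-distribˡ-+₃ (w s) _ _ _ ⟨
  w s * (below T s * M (pred s) r + diag T s * M s r + upper T s * M (suc s) r)
    ∎
  where
  term : ∀ k {t t′} → w k * t ≡ w s * t′ → w r * (M r k * t) ≡ w s * (t′ * M k r)
  term k = transfer-weight {w r} {w k} {w s} {M r k} {M k r} (wM r k)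
  weight-above : ∀ s → w (pred s) * above T s ≡ w s * below T s
  weight-above zero = refl
  weight-above (suc s) = sym (wT s)

𝒫 : Tridiagonal
𝒫 = record { lower = λ _ → 1ℤ ; diag = λ r → + r - 1ℤ ; upper = λ r → - (+ r) - 1ℤ }

P-diagonal : ∀ r → P r r ≡ diag 𝒫 r
P-diagonal r with r ≟ r
... | yes _ = refl
... | no r≢r = ⊥-elim (r≢r refl)

P-subdiagonal : ∀ s → P (suc s) s ≡ lower 𝒫 s
P-subdiagonal s with s ≟ suc s
... | yes s≡1+s = ⊥-elim (1+n≢n (sym s≡1+s))
... | no _ with suc s ≟ suc s
...   | yes _ = refl
...   | no 1+s≢1+s = ⊥-elim (1+s≢1+s refl)

P-superdiagonal : ∀ r → P r (suc r) ≡ upper 𝒫 r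
P-superdiagonal r with suc r ≟ r
... | yes 1+r≡r = ⊥-elim (1+n≢n 1+r≡r)
... | no _ with r ≟ suc (suc r)
...   | yes r≡2+r = ⊥-elim (<⇒≢ (<-trans (n<1+n r) (n<1+n (suc r))) r≡2+r)
...   | no _ with suc r ≟ suc r
...     | yes _ = refl
...     | no 1+r≢1+r = ⊥-elim (1+r≢1+r refl)

P-far-above : ∀ k s → suc k < s → P k s ≡ 0ℤ
P-far-above k s 1+k<s with s ≟ k
... | yes s≡k = ⊥-elim (<⇒≢ (<-trans (n<1+n k) 1+k<s) (sym s≡k))
... | no _ with k ≟ suc s
...   | yes k≡1+s = ⊥-elim (<⇒≢ (<-trans (<-trans (n<1+n k) 1+k<s) (n<1+n s)) k≡1+s)
...   | no _ with s ≟ suc k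
...     | yes s≡1+k = ⊥-elim (<⇒≢ 1+k<s (sym s≡1+k))
...     | no _ = refl

-- The sum defining Ppow (suc j) r s runs over k ≤ s + 1; only its last three terms survive.
Σ<-column-𝒫 : ∀ (M : Matrix) r s → Σ< (suc (suc s)) (λ k → M r k * P k s) ≡ (M ⊙ 𝒫) r s
Σ<-column-𝒫 M r s = begin
  Σ< (suc (suc s)) g              ≡⟨ Σ<-suc (suc s) g ⟩
  Σ< (suc s) g + g (suc s)        ≡⟨ cong (_+ g (suc s)) (Σ<-suc s g) ⟩
  Σ< s g + g s + g (suc s)        ≡⟨ cong₂ _+_ (cong₂ _+_ (head s) (cong (M r s *_) (P-diagonal s)))
                                               (cong (M r (suc s) *_) (P-subdiagonal s)) ⟩
  (M ⊙ 𝒫) r s                     ∎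
  where
  g : ℕ → ℤ
  g k = M r k * P k s
  head : ∀ s → Σ< s (λ k → M r k * P k s) ≡ M r (pred s) * above 𝒫 s
  head zero = sym (*-zeroʳ (M r 0))
  head (suc s) = begin
    Σ< (suc s) (λ k → M r k * P k (suc s))            ≡⟨ Σ<-suc s _ ⟩
    Σ< s (λ k → M r k * P k (suc s)) + M r s * P s (suc s)
      ≡⟨ cong₂ _+_ (Σ<-vanishing s _ (λ k k<s → trans (cong (M r k *_) (P-far-above k (suc s) (s≤s k<s)))
                                                       (*-zeroʳ (M r k))))
                   (cong (M r s *_) (P-superdiagonal s)) ⟩
    0ℤ + M r s * upper 𝒫 s                             ≡⟨ +-identityˡ _ ⟩
    M r s * upper 𝒫 s                                  ∎

Ppow-suc : ∀ j → Ppow (suc j) ≈ Ppow j ⊙ 𝒫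
Ppow-suc j = Σ<-column-𝒫 (Ppow j)

Ppow-suc′ : ∀ j → Ppow (suc j) ≈ 𝒫 ⊛ Ppow j
Ppow-suc′ zero r s = begin
  Ppow 1 r s         ≡⟨ Ppow-suc 0 r s ⟩
  (I ⊙ 𝒫) r s        ≡⟨ I-⊙≈⊛-I 𝒫 r s ⟩
  (𝒫 ⊛ I) r s        ∎
Ppow-suc′ (suc j) r s = begin
  Ppow (suc (suc j)) r s        ≡⟨ Ppow-suc (suc j) r s ⟩
  (Ppow (suc j) ⊙ 𝒫) r s        ≡⟨ ⊙-cong 𝒫 (Ppow-suc′ j) r s ⟩
  (𝒫 ⊛ Ppow j ⊙ 𝒫) r s          ≡⟨ ⊛-⊙-assoc 𝒫 (Ppow j) 𝒫 r s ⟨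
  (𝒫 ⊛ (Ppow j ⊙ 𝒫)) r s        ≡⟨ ⊛-cong 𝒫 (Ppow-suc j) r s ⟨
  (𝒫 ⊛ Ppow (suc j)) r s        ∎

signedFactorial : ℕ → ℤ
signedFactorial r = (- 1ℤ) ^ r * + (r !)

signedFactorial-symmetrizes-𝒫 : Symmetrizesᵗ signedFactorial 𝒫
signedFactorial-symmetrizes-𝒫 k = begin
  - 1ℤ * e * + (suc k !) * 1ℤ         ≡⟨ cong (λ t → - 1ℤ * e * t * 1ℤ) (pos-* (suc k) (k !)) ⟩
  - 1ℤ * e * ((1ℤ + x) * f) * 1ℤ      ≡⟨ rearrange e x f ⟩
  e * f * (- x - 1ℤ)                  ∎
  where
  e = (- 1ℤ) ^ k; x = + k; f = + (k !)
  rearrange : ∀ e x f → - 1ℤ * e * ((1ℤ + x) * f) * 1ℤ ≡ e * f * (- x - 1ℤ)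
  rearrange = solve-∀

signedFactorial-symmetrizes-Ppow : ∀ j → Symmetrizes signedFactorial (Ppow j)
signedFactorial-symmetrizes-Ppow zero = symmetrizes-identity signedFactorial
signedFactorial-symmetrizes-Ppow (suc j) r s = begin
  σ r * Ppow (suc j) r s     ≡⟨ cong (σ r *_) (Ppow-suc j r s) ⟩
  σ r * (Ppow j ⊙ 𝒫) r s     ≡⟨ ⊙-transpose-⊛ {σ} {𝒫} {Ppow j} signedFactorial-symmetrizes-𝒫 (signedFactorial-symmetrizes-Ppow j) r s ⟩
  σ s * (𝒫 ⊛ Ppow j) s r     ≡⟨ cong (σ s *_) (Ppow-suc′ j s r) ⟨
  σ s * Ppow (suc j) s r     ∎
  where σ = signedFactorial

-- The identity holds for j = 0 as well.
lemma3p3 : (j : ℕ) → 1 ≤ j → (r s : ℕ) →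
    ((- 1ℤ) ^ r) * (+ (r !)) * Ppow j r s ≡ ((- 1ℤ) ^ s) * (+ (s !)) * Ppow j s r
lemma3p3 j _ = signedFactorial-symmetrizes-Ppow j
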